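{- Let $c$ be an instance of $C_{\boxplus}$. Then $c$ has at most one $R$-successor in each of the nine concept extensions $A_{k\ell}$ ($0\le k,\ell\le 2$).
   Context: We work in the description logic $\mathcal{ALCN}$ extended with role composition $\circ$ and role inverse ${}^-$ in both value and number restrictions. $R$ is an atomic role; $C_{ij}$ and $A_{ij}$ ($0\le i,j\le 2$) are atomic concepts; $a\oplus b=(a+b)\bmod 3$; $X\Rightarrow Y$ abbreviates $\neg X\sqcup Y$; $\exists R.D$ and $\forall R.D$ are the usual existential and value restrictions, and $(\le n\, S)$ denotes the unqualified at-most restriction on the (possibly complex) role $S$. Define $C := \bigsqcup_{0\le i,j\le 2}\big(C_{ij}\sqcap D^C_{ij}\big)$, where $D^C_{ij}$ is the conjunction of $\neg C_{k\ell}$ over all $0\le k,\ell\le 2$ with $(k,\ell)\ne(i,j)$ (so each instance of $C$ lies in exactly one $C_{ij}$); $A := \bigsqcup_{0\le i,j\le 2}\big(A_{ij}\sqcap D^A_{ij}\big)\sqcap\neg C$, where $D^A_{ij}$ is the conjunction of $\neg A_{k\ell}$ over all $0\le k,\ell\le 2$ with $(k,\ell)\ne(i,j)$; $C_{\boxplus} := C\sqcap(\le 4\, R)\sqcap\forall R.A_{\boxplus}\sqcap(\le 9\, R\circ R^-)\sqcap E_C$, where $E_C$ is the conjunction over all $0\le i,j\le 2$ of $C_{ij}\Rightarrow(\exists R.A_{ij}\sqcap\exists R.A_{i\oplus1,j}\sqcap\exists R.A_{i,j\oplus1}\sqcap\exists R.A_{i\oplus1,j\oplus1})$; $A_{\boxplus}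 := A\sqcap E_A$, where $E_A$ is the conjunction over all $0\le i,j\le 2$ of $A_{ij}\Rightarrow(\exists R^-.C_{ij}\sqcap\exists R^-.C_{i\oplus2,j}\sqcap\exists R^-.C_{i,j\oplus2}\sqcap\exists R^-.C_{i\oplus2,j\oplus2})$. -}

module Defs where

open import Data.Nat using (ℕ; suc; _+_; _%_)
open import Data.Nat.DivMod using (m%n<n)
open import Data.Fin using (Fin; toℕ; fromℕ<; zero; suc)
open import Data.Product using (Σ; _×_; _,_)
open import Data.Sum using (_⊎_)
open import Relation.Nullary using (¬_)
open import Relation.Binary.PropositionalEquality using (_≡_; _≢_)
open import Function.Definitions using (Injective)

Idx : Set
Idx = Fin 3

_⊕_ : Idx → Idx → Idx
a ⊕ b = fromℕ< (m%n<n (toℕ a + toℕ b) 3)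

one two : Idx
one = suc zero
two = suc (suc zero)

record Interp : Set₁ where
  field
    Δ   : Set
    R   : Δ → Δ → Set
    Cat : Idx → Idx → Δ → Set
    Aat : Idx → Idx → Δ → Set

module Semantics (I : Interp) where
  open Interp I

  Concept : Set₁
  Concept = Δ → Set

  Role : Set₁
  Role = Δ → Δ → Set

  _⊓_ : Concept → Concept → Concept
  (X ⊓ Y) x = X x × Y x

  _⊔_ : Concept → Concept → Concept
  (X ⊔ Y) x = X x ⊎ Y x

  ∼_ : Concept → Concept
  (∼ X) x = ¬ X x

  _⇒_ : Concept → Concept → Concept
  X ⇒ Y = (∼ X) ⊔ Y

  ∃[_]_ : Role → Concept → Concept
  (∃[ S ] X) x = Σ Δ λ y → S x y × X y

  ∀[_]_ : Role → Concept → Concept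
  (∀[ S ] X) x = ∀ y → S x y → X y

  _∘ʳ_ : Role → Role → Role
  (S ∘ʳ T) x z = Σ Δ λ y → S x y × T y z

  _⁻ : Role → Role
  (S ⁻) x y = S y x

  AtMost : ℕ → (Δ → Set) → Set
  AtMost n P = ∀ (f : Fin (suc n) → Δ) → Injective _≡_ _≡_ f → ¬ (∀ i → P (f i))

  ≤[_]_ : ℕ → Role → Concept
  (≤[ n ] S) x = AtMost n (S x)

  ⨆ : (Idx → Idx → Concept) → Concept
  ⨆ F x = Σ Idx λ i → Σ Idx λ j → F i j x

  ⨅ : (Idx → Idx → Concept) → Concept
  ⨅ F x = ∀ i j → F i j x

  DC : Idx → Idx → Concept
  DC i j x = ∀ k l → (k , l) ≢ (i , j) → ¬ Cat k l x

  DA : Idx → Idx → Concept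
  DA i j x = ∀ k l → (k , l) ≢ (i , j) → ¬ Aat k l x

  Cc : Concept
  Cc = ⨆ λ i j → Cat i j ⊓ DC i j

  Ac : Concept
  Ac = (⨆ λ i j → Aat i j ⊓ DA i j) ⊓ (∼ Cc)

  EC : Concept
  EC = ⨅ λ i j → Cat i j ⇒
         ((∃[ R ] Aat i j) ⊓ ((∃[ R ] Aat (i ⊕ one) j) ⊓
          ((∃[ R ] Aat i (j ⊕ one)) ⊓ (∃[ R ] Aat (i ⊕ one) (j ⊕ one)))))

  EA : Concept
  EA = ⨅ λ i j → Aat i j ⇒
         ((∃[ R ⁻ ] Cat i j) ⊓ ((∃[ R ⁻ ] Cat (i ⊕ two) j) ⊓
          ((∃[ R ⁻ ] Cat i (j ⊕ two)) ⊓ (∃[ R ⁻ ] Cat (i ⊕ two) (j ⊕ two)))))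

  A⊞ : Concept
  A⊞ = Ac ⊓ EA

  C⊞ : Concept
  C⊞ = Cc ⊓ ((≤[ 4 ] R) ⊓ ((∀[ R ] A⊞) ⊓ ((≤[ 9 ] (R ∘ʳ (R ⁻))) ⊓ EC)))

-- Every R-successor of c lies in exactly one class A_kl, and E_C provides successors in the
-- four distinct classes of the square with corner (i , j), where c ∈ C_ij. If two distinct
-- successors shared a class, they together with successors for three square classes other
-- than theirs would be five distinct successors, contradicting (≤ 4 R).
module Submission where

open import Defs
open import Data.Nat using (ℕ; suc)
open import Data.Empty using (⊥-elim)
open import Data.Fin using (zero; suc; punchIn)
open import Data.Fin.Properties using (_≟_; any?; punchIn-injective; punchInᵢ≢i; 0≢1+n)
open import Data.Product using (∃; _×_; _,_; proj₁; proj₂)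
open import Data.Product.Properties using (≡-dec)
open import Data.Sum using (inj₁; inj₂)
open import Data.Vec using (Vec; []; _∷_; lookup)
open import Data.Vec.Functional as Vector using (Vector)
open import Data.Vec.Relation.Unary.All using (All; []; _∷_)
open import Data.Vec.Relation.Unary.All.Properties using (lookup⁺)
open import Data.Vec.Relation.Unary.AllPairs using ([]; _∷_)
open import Data.Vec.Relation.Unary.Unique.Propositional using (Unique)
open import Data.Vec.Relation.Unary.Unique.Propositional.Properties using (lookup-injective)
open import Function using (_∘_)
open import Function.Definitions using (Injective)
open import Relation.Binary.Definitions using (DecidableEquality)
open import Relation.Nullary using (yes; no)
open import Relation.Binary.PropositionalEquality using (_≡_; _≢_; refl; sym; trans; cong; subst)

private variable
  A : Set
  n : ℕ

fresh∷-injective : {f : Vector A n} {a : A} →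
  Injective _≡_ _≡_ f → (∀ i → f i ≢ a) → Injective _≡_ _≡_ (a Vector.∷ f)
fresh∷-injective f-inj fresh {zero}  {zero}  _    = refl
fresh∷-injective f-inj fresh {zero}  {suc j} a≡fj = ⊥-elim (fresh j (sym a≡fj))
fresh∷-injective f-inj fresh {suc i} {zero}  fi≡a = ⊥-elim (fresh i fi≡a)
fresh∷-injective f-inj fresh {suc i} {suc j} fi≡fj = cong suc (f-inj fi≡fj)

punchIn-avoiding : DecidableEquality A → (g : Vector A (suc n)) → Injective _≡_ _≡_ g →
  (q : A) → ∃ λ a → ∀ i → g (punchIn a i) ≢ q
punchIn-avoiding _≟ᴬ_ g g-inj q with any? (λ a → g a ≟ᴬ q)
... | yes (a , ga≡q) = a , λ i e → punchInᵢ≢i a i (g-inj (trans e (sym ga≡q)))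
... | no  q∉g        = zero , λ i e → q∉g (punchIn zero i , e)

_≟²_ : DecidableEquality (Idx × Idx)
_≟²_ = ≡-dec _≟_ _≟_

x≢x⊕one : ∀ x → x ≢ x ⊕ one
x≢x⊕one zero             ()
x≢x⊕one (suc zero)       ()
x≢x⊕one (suc (suc zero)) ()

square : Idx → Idx → Vec (Idx × Idx) 4
square i j = (i , j) ∷ (i ⊕ one , j) ∷ (i , j ⊕ one) ∷ (i ⊕ one , j ⊕ one) ∷ []

square-unique : ∀ i j → Unique (square i j)
square-unique i j =
  (i≢ ∘ cong proj₁ ∷ j≢ ∘ cong proj₂ ∷ i≢ ∘ cong proj₁ ∷ []) ∷
  (i≢ ∘ sym ∘ cong proj₁ ∷ j≢ ∘ cong proj₂ ∷ []) ∷
  (i≢ ∘ cong proj₁ ∷ []) ∷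
  [] ∷
  []
  where
  i≢ : i ≢ i ⊕ one
  i≢ = x≢x⊕one i
  j≢ : j ≢ j ⊕ one
  j≢ = x≢x⊕one j

module _ (I : Interp) where
  open Interp I
  open Semantics I

  Class : Idx × Idx → Concept
  Class (k , l) = Aat k l

  Ac-class-unique : ∀ {x p q} → Ac x → Class p x → Class q x → p ≡ q
  Ac-class-unique {p = k , l} {q = k′ , l′} ((i , j , _ , only-ij) , _) px qx
    with (k , l) ≟² (i , j) | (k′ , l′) ≟² (i , j)
  ... | yes p≡ij | yes q≡ij = trans p≡ij (sym q≡ij)
  ... | no  p≢ij | _        = ⊥-elim (only-ij k l p≢ij px)
  ... | _        | no  q≢ij = ⊥-elim (only-ij k′ l′ q≢ij qx)

  class-≢⇒≢ : ∀ {x y p q} → Ac x → Class p x → Class q y → p ≢ q → x ≢ y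
  class-≢⇒≢ ax px qy p≢q refl = p≢q (Ac-class-unique ax px qy)

  class-injective : {f : Vector Δ n} {g : Vector (Idx × Idx) n} →
    (∀ i → Ac (f i)) → (∀ i → Class (g i) (f i)) →
    Injective _≡_ _≡_ g → Injective _≡_ _≡_ f
  class-injective {g = g} ac cls g-inj {i} {j} fi≡fj =
    g-inj (Ac-class-unique (ac i) (cls i) (subst (Class (g j)) (sym fi≡fj) (cls j)))

  square-successors : ∀ {c i j} → Cat i j c → EC c →
    All (λ p → (∃[ R ] Class p) c) (square i j)
  square-successors {i = i} {j} cij ec with ec i j
  ... | inj₁ ¬cij                = ⊥-elim (¬cij cij)
  ... | inj₂ (w₀ , w₁ , w₂ , w₃) = w₀ ∷ w₁ ∷ w₂ ∷ w₃ ∷ []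

  one-successor-per-class : ∀ {c} → (≤[ suc n ] R) c → (∀[ R ] Ac) c →
    (ps : Vec (Idx × Idx) (suc n)) → Unique ps → All (λ p → (∃[ R ] Class p) c) ps →
    ∀ q → AtMost 1 (λ y → R c y × Class q y)
  one-successor-per-class {n} {c} at-most succ-Ac ps ps-unique ps-realised q f f-inj fR =
    at-most ys ys-injective ys-successors
    where
    y₁ y₂ : Δ
    y₁ = f zero
    y₂ = f (suc zero)

    avoiding : ∃ λ a → ∀ i → lookup ps (punchIn a i) ≢ q
    avoiding = punchIn-avoiding _≟²_ (lookup ps) (lookup-injective ps-unique _ _) q

    witness : ∀ i → (∃[ R ] Class (lookup ps (punchIn (proj₁ avoiding) i))) c
    witness i = lookup⁺ ps-realised (punchIn (proj₁ avoiding) i)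

    u : Vector Δ n
    u i = proj₁ (witness i)

    u-succ : ∀ i → R c (u i)
    u-succ i = proj₁ (proj₂ (witness i))

    u-Ac : ∀ i → Ac (u i)
    u-Ac i = succ-Ac _ (u-succ i)

    u-fresh : ∀ {y} → Class q y → ∀ i → u i ≢ y
    u-fresh qy i = class-≢⇒≢ (u-Ac i) (proj₂ (proj₂ (witness i))) qy (proj₂ avoiding i)

    u-injective : Injective _≡_ _≡_ u
    u-injective = class-injective u-Ac (proj₂ ∘ proj₂ ∘ witness)
      (λ {i} {j} → punchIn-injective (proj₁ avoiding) i j ∘ lookup-injective ps-unique _ _)

    y₁-fresh : ∀ i → (y₂ Vector.∷ u) i ≢ y₁
    y₁-fresh zero    y₂≡y₁ = 0≢1+n (f-inj (sym y₂≡y₁))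
    y₁-fresh (suc i) = u-fresh (proj₂ (fR zero)) i

    ys : Vector Δ (suc (suc n))
    ys = y₁ Vector.∷ y₂ Vector.∷ u

    ys-injective : Injective _≡_ _≡_ ys
    ys-injective =
      fresh∷-injective (fresh∷-injective u-injective (u-fresh (proj₂ (fR (suc zero))))) y₁-fresh

    ys-successors : ∀ i → R c (ys i)
    ys-successors zero          = proj₁ (fR zero)
    ys-successors (suc zero)    = proj₁ (fR (suc zero))
    ys-successors (suc (suc i)) = u-succ i

lemma1 : (I : Interp) → (c : Interp.Δ I) → Semantics.C⊞ I c →
    (k l : Idx) →
    Semantics.AtMost I 1 (λ y → Interp.R I c y × Interp.Aat I k l y)
lemma1 I c ((i , j , cij , _) , at-most , succ-A⊞ , _ , ec) k l =
  one-successor-per-class I at-most (λ y r → proj₁ (succ-A⊞ y r))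
    (square i j) (square-unique i j) (square-successors I cij ec) (k , l)
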